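{- The lattice $\mathcal{P}(n;\epsilon)$ is lexicographically shellable, i.e. it is graded and admits an $EL$-labeling.
   Context: A network on $n$ points is a set $E$ of pairs $(i,j)$ with $1\le i<j\le n$ (directed edges; $i$ a source, $j$ a sink) with no $(i,j),(j,k)\in E$, satisfying (B1): if $(i,k),(j,l)\in E$ with $i<j<k<l$ then $(j,k)\in E$. Let $\epsilon\in\{1,0,-1\}^n$ have first nonzero entry (if any) equal to $1$; $\mathcal{N}(n;\epsilon)$ is the set of such networks in which every source $i$ has $\epsilon_i=1$ and every sink $j$ has $\epsilon_j=-1$. $\mathcal{E}(x)$ is the edge set of $x$, $\rho(x)=|\mathcal{E}(x)|$; $x\lessdot y$ iff $\rho(y)=\rho(x)+1$ and $\mathcal{E}(x)\subset\mathcal{E}(y)$; $x\le y$ iff there is a chain of covers from $x$ to $y$; $\mathcal{P}(n;\epsilon)=(\mathcal{N}(n;\epsilon),\le)$. An edge-labeling assigns to each cover an element of a totally ordered set; a chain $x_0\lessdot\cdots\lessdot x_k$ is rising if its labels are weakly increasing. An $EL$-labeling is one such that every interval $[x,y]$ has a unique rising unrefinable chain $x=x_0\lessdot x_1\lessdot\cdots\lessdot x_k=y$, and whenever $x\lessdot z\le y$, $z\ne x_1$, one has $\lambda(x,x_1)<\lambda(x,z)$. -}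

module Defs where

open import Level using (0ℓ)
open import Data.Nat using (ℕ; zero; suc; _+_)
open import Data.Bool using (Bool; true; false)
open import Data.Fin using (Fin; _<_)
open import Data.Vec using (Vec; lookup; foldr; map)
open import Data.List using (List; []; _∷_)
open import Data.Product using (Σ; _×_; ∃; ∃-syntax)
open import Data.Sum using (_⊎_)
open import Data.Unit using (⊤)
open import Relation.Nullary using (¬_)
open import Relation.Binary.PropositionalEquality using (_≡_; _≢_)
open import Relation.Binary.Bundles using (TotalOrder)

data Sign : Set where
  plus zer minus : Sign

FirstNonzeroPlus : ∀ {n} → Vec Sign n → Set
FirstNonzeroPlus {n} ε =
  ∀ (i : Fin n) → lookup ε i ≢ zer → (∀ (j : Fin n) → j < i → lookup ε j ≡ zer) →
  lookup ε i ≡ plus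

-- A candidate edge set on points Fin n (point i ↔ i+1): adjacency matrix,
-- entry (i , j) = true iff (i , j) ∈ E.
Adj : ℕ → Set
Adj n = Vec (Vec Bool n) n

Edge : ∀ {n} → Adj n → Fin n → Fin n → Set
Edge E i j = lookup (lookup E i) j ≡ true

record IsNetwork {n : ℕ} (ε : Vec Sign n) (E : Adj n) : Set where
  field
    ordered  : ∀ i j → Edge E i j → i < j
    noPath   : ∀ i j k → Edge E i j → ¬ Edge E j k
    B1       : ∀ i j k l → i < j → j < k → k < l →
               Edge E i k → Edge E j l → Edge E j k
    srcSign  : ∀ i j → Edge E i j → lookup ε i ≡ plus
    sinkSign : ∀ i j → Edge E i j → lookup ε j ≡ minus

countTrue : ∀ {m} → Vec Bool m → ℕ
countTrue = foldr _ (λ { true r → suc r ; false r → r }) 0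

rank : ∀ {n} → Adj n → ℕ
rank E = foldr _ _+_ 0 (map countTrue E)

module _ {n : ℕ} (ε : Vec Sign n) where

  Cover : Adj n → Adj n → Set
  Cover x y = IsNetwork ε x × IsNetwork ε y × rank y ≡ suc (rank x) ×
              (∀ i j → Edge x i j → Edge y i j)

  -- unrefinable chain x = x₀ ⋖ x₁ ⋖ ⋯ ⋖ x_k = y, listed as x₁ … x_k
  Path : Adj n → List (Adj n) → Adj n → Set
  Path x []       y = x ≡ y
  Path x (z ∷ zs) y = Cover x z × Path z zs y

  _≤P_ : Adj n → Adj n → Set
  x ≤P y = ∃[ zs ] Path x zs y

  -- graded (all maximal chains of the poset have the same length), via a rank function
  PosetCover : Adj n → Adj n → Set
  PosetCover x y = IsNetwork ε x × IsNetwork ε y × x ≤P y × x ≢ y ×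
    (∀ z → IsNetwork ε z → x ≤P z → z ≤P y → z ≡ x ⊎ z ≡ y)

  Minimal Maximal : Adj n → Set
  Minimal x = IsNetwork ε x × (∀ z → IsNetwork ε z → z ≤P x → z ≡ x)
  Maximal x = IsNetwork ε x × (∀ z → IsNetwork ε z → x ≤P z → z ≡ x)

  Graded : Set
  Graded = Σ (Adj n → ℕ) λ r →
    (∀ x y → PosetCover x y → r y ≡ suc (r x)) ×
    (∀ x → Minimal x → r x ≡ 0) ×
    (∀ x y → Maximal x → Maximal y → r x ≡ r y)

  module _ (T : TotalOrder 0ℓ 0ℓ 0ℓ) (lab : Adj n → Adj n → TotalOrder.Carrier T) where
    open TotalOrder T renaming (_≤_ to _≤L_; _≈_ to _≈L_)

    _<L_ : Carrier → Carrier → Set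
    a <L b = a ≤L b × ¬ (a ≈L b)

    Rising : Adj n → List (Adj n) → Set
    Rising x []           = ⊤
    Rising x (z ∷ [])     = ⊤
    Rising x (z ∷ w ∷ zs) = lab x z ≤L lab z w × Rising z (w ∷ zs)

    FirstLeast : Adj n → List (Adj n) → Adj n → Set
    FirstLeast x []        y = ⊤
    FirstLeast x (x₁ ∷ zs) y =
      ∀ z → Cover x z → z ≤P y → z ≢ x₁ → lab x x₁ <L lab x z

    IsEL : Set
    IsEL = ∀ x y → IsNetwork ε x → IsNetwork ε y → x ≤P y →
      Σ (List (Adj n)) λ zs → Path x zs y × Rising x zs ×
        (∀ ws → Path x ws y → Rising x ws → ws ≡ zs) ×
        FirstLeast x zs y

  ELShellable : Set₁
  ELShellable = Graded × Σ (TotalOrder 0ℓ 0ℓ 0ℓ) λ T →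
    Σ (Adj n → Adj n → TotalOrder.Carrier T) λ lab → IsEL T lab

{-# OPTIONS --safe #-}
module Submission where

-- Label the cover x ⋖ x ∪ {(a , b)} by the key (b − a , a), ordered lexicographically.
-- If x ⊆ y are networks, then adding to x the new edge of y with least key yields a
-- network again: a violation of (B1) would force an edge (j , k) of y that is strictly
-- shorter than the added one, hence already in x. Iterating gives a rising chain from x
-- to y; conversely a rising chain must add the least remaining edge at every step, which
-- gives both its uniqueness and the minimality of its first label. In particular x ≤ y
-- iff x ⊆ y, so the number of edges grades the poset, between the empty network and the
-- network of all admissible edges.

open import Defs
open import Level using (0ℓ)
open import Function using (_∘_; _⇔_; mk⇔; case_of_; Equivalence)
open import Data.Nat using (ℕ; zero; suc; _+_; _∸_; z≤n; s≤s) renaming (_≤_ to _≤ℕ_)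
open import Data.Nat.Properties
  using (suc-injective; m≤n⇒m≤1+n; 1+n≰n; 1+n≢n; ≤-refl; ≤-antisym; <⇒≤; <⇒≱; ≮⇒≥; <-irrefl;
         m≤n+m; +-suc; +-mono-≤; +-mono-<-≤; +-cancelˡ-≡; +-cancelʳ-≡; m∸n+n≡m; ∸-monoˡ-<; ∸-monoʳ-<;
         ≤-decTotalOrder; ≤-totalOrder)
open import Data.Bool using (Bool; true; false)
import Data.Bool.Properties as Bool
open import Data.Fin using (Fin; toℕ; _<_)
import Data.Fin as Fin
open import Data.Fin.Properties using (toℕ-injective; _<?_)
open import Data.Vec using (Vec; []; _∷_; lookup; replicate; tabulate; _[_]≔_)
open import Data.Vec.Properties using (lookup∘update; lookup∘update′; lookup-replicate; lookup∘tabulate)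
open import Data.List using (List; []; _∷_; length; allFin; cartesianProduct; filter)
open import Data.List.Membership.Propositional using (_∈_)
open import Data.List.Membership.Propositional.Properties
  using (∈-allFin; ∈-cartesianProduct⁺; ∈-filter⁺; ∈-filter⁻)
open import Data.List.Relation.Unary.Any using (here; there)
import Data.List.Relation.Unary.All as All
import Data.List.Extrema
open import Data.Product using (Σ; _×_; _,_; proj₁; proj₂; ∃; ∃₂; uncurry)
open import Data.Product.Properties using (≡-dec)
open import Data.Product.Relation.Binary.Lex.NonStrict using (×-totalOrder)
open import Data.Sum using (_⊎_; inj₁; inj₂; [_,_]′)
open import Data.Unit using (tt)
open import Relation.Nullary using (¬_; Dec; yes; no; does; contradiction; _×-dec_; ¬?)
open import Relation.Unary using (Pred; Decidable)
open import Relation.Binary.Definitions using (DecidableEquality)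
open import Relation.Binary.PropositionalEquality
open import Relation.Binary.Bundles using (TotalOrder)

module _ {a ℓ₁ ℓ₂ ℓ p} (T : TotalOrder ℓ ℓ₁ ℓ₂) {A : Set a} {P : Pred A p} (P? : Decidable P)
         (f : A → TotalOrder.Carrier T) where
  open TotalOrder T using (_≤_)
  open Data.List.Extrema T using (argmin; argmin-sel; f[argmin]≤f[⊤]; f[argmin]≤f[xs])

  leastBy : (xs : List A) →
            (∀ {x} → x ∈ xs → ¬ P x) ⊎ Σ A λ a → P a × ∀ {x} → x ∈ xs → P x → f a ≤ f x
  leastBy xs with filter P? xs in eq
  ... | [] = inj₁ λ x∈xs px → case subst (_ ∈_) eq (∈-filter⁺ P? x∈xs px) of λ ()
  ... | y ∷ ys = inj₂ (argmin f y ys , P-argmin , argmin-least)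
    where
    argmin∈ : argmin f y ys ∈ y ∷ ys
    argmin∈ with argmin-sel f y ys
    ... | inj₁ e = here e
    ... | inj₂ m = there m
    P-argmin : P (argmin f y ys)
    P-argmin = proj₂ (∈-filter⁻ P? {xs = xs} (subst (_ ∈_) (sym eq) argmin∈))
    argmin-least : ∀ {x} → x ∈ xs → P x → f (argmin f y ys) ≤ f x
    argmin-least x∈xs px with subst (_ ∈_) eq (∈-filter⁺ P? x∈xs px)
    ... | here refl = f[argmin]≤f[⊤] {f = f} y ys
    ... | there x∈ys = All.lookup (f[argmin]≤f[xs] {f = f} y ys) x∈ys

private variable
  k m : ℕ

_⊆ᵛ_ : Vec Bool k → Vec Bool k → Set
u ⊆ᵛ v = ∀ j → lookup u j ≡ true → lookup v j ≡ true

_⊆_ : Vec (Vec Bool k) m → Vec (Vec Bool k) m → Set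
x ⊆ y = ∀ i → lookup x i ⊆ᵛ lookup y i

countTrue-mono : (u v : Vec Bool k) → u ⊆ᵛ v → countTrue u ≤ℕ countTrue v
countTrue-mono []          []          _ = z≤n
countTrue-mono (true ∷ u)  (true ∷ v)  s = s≤s (countTrue-mono u v (s ∘ Fin.suc))
countTrue-mono (true ∷ u)  (false ∷ v) s = contradiction (s Fin.zero refl) λ ()
countTrue-mono (false ∷ u) (true ∷ v)  s = m≤n⇒m≤1+n (countTrue-mono u v (s ∘ Fin.suc))
countTrue-mono (false ∷ u) (false ∷ v) s = countTrue-mono u v (s ∘ Fin.suc)

⊆ᵛ∧countTrue≡⇒≡ : (u v : Vec Bool k) → u ⊆ᵛ v → countTrue u ≡ countTrue v → u ≡ v
⊆ᵛ∧countTrue≡⇒≡ []          []          _ _ = refl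
⊆ᵛ∧countTrue≡⇒≡ (true ∷ u)  (true ∷ v)  s e =
  cong (true ∷_) (⊆ᵛ∧countTrue≡⇒≡ u v (s ∘ Fin.suc) (suc-injective e))
⊆ᵛ∧countTrue≡⇒≡ (true ∷ u)  (false ∷ v) s e = contradiction (s Fin.zero refl) λ ()
⊆ᵛ∧countTrue≡⇒≡ (false ∷ u) (true ∷ v)  s e =
  contradiction (subst (_≤ℕ countTrue v) e (countTrue-mono u v (s ∘ Fin.suc))) 1+n≰n
⊆ᵛ∧countTrue≡⇒≡ (false ∷ u) (false ∷ v) s e =
  cong (false ∷_) (⊆ᵛ∧countTrue≡⇒≡ u v (s ∘ Fin.suc) e)

countTrue-set : (v : Vec Bool k) (j : Fin k) → lookup v j ≡ false →
                countTrue (v [ j ]≔ true) ≡ suc (countTrue v)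
countTrue-set (false ∷ v) Fin.zero    _ = refl
countTrue-set (true ∷ v)  (Fin.suc j) e = cong suc (countTrue-set v j e)
countTrue-set (false ∷ v) (Fin.suc j) e = countTrue-set v j e

totalTrue : Vec (Vec Bool k) m → ℕ
totalTrue x = Data.Vec.foldr _ _+_ 0 (Data.Vec.map countTrue x)

totalTrue-mono : (x y : Vec (Vec Bool k) m) → x ⊆ y → totalTrue x ≤ℕ totalTrue y
totalTrue-mono []      []      _ = z≤n
totalTrue-mono (u ∷ x) (v ∷ y) s =
  +-mono-≤ (countTrue-mono u v (s Fin.zero)) (totalTrue-mono x y (s ∘ Fin.suc))

+-mono-≤-≡⇒≡ˡ : ∀ {a b c d} → a ≤ℕ c → b ≤ℕ d → a + b ≡ c + d → a ≡ c
+-mono-≤-≡⇒≡ˡ a≤c b≤d e = ≤-antisym a≤c (≮⇒≥ λ a<c → <-irrefl e (+-mono-<-≤ a<c b≤d))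

⊆∧totalTrue≡⇒≡ : (x y : Vec (Vec Bool k) m) → x ⊆ y → totalTrue x ≡ totalTrue y → x ≡ y
⊆∧totalTrue≡⇒≡ []      []      _ _ = refl
⊆∧totalTrue≡⇒≡ (u ∷ x) (v ∷ y) s e = cong₂ _∷_
    (⊆ᵛ∧countTrue≡⇒≡ u v (s Fin.zero) u≡v)
    (⊆∧totalTrue≡⇒≡ x y (s ∘ Fin.suc) (+-cancelˡ-≡ (countTrue v) _ _ (subst (λ c → c + _ ≡ _) u≡v e)))
  where
  u≡v = +-mono-≤-≡⇒≡ˡ (countTrue-mono u v (s Fin.zero)) (totalTrue-mono x y (s ∘ Fin.suc)) e

totalTrue-set : (x : Vec (Vec Bool k) m) (i : Fin m) (r : Vec Bool k) →
                countTrue r ≡ suc (countTrue (lookup x i)) → totalTrue (x [ i ]≔ r) ≡ suc (totalTrue x)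
totalTrue-set (u ∷ x) Fin.zero    r e = cong (_+ totalTrue x) e
totalTrue-set (u ∷ x) (Fin.suc i) r e = trans (cong (countTrue u +_) (totalTrue-set x i r e)) (+-suc _ _)

totalTrue-replicate-false : ∀ m k → totalTrue (replicate m (replicate k false)) ≡ 0
totalTrue-replicate-false zero    k = refl
totalTrue-replicate-false (suc m) k = cong₂ _+_ (countTrue-replicate-false k) (totalTrue-replicate-false m k)
  where
  countTrue-replicate-false : ∀ k → countTrue (replicate k false) ≡ 0
  countTrue-replicate-false zero    = refl
  countTrue-replicate-false (suc k) = countTrue-replicate-false k

private variable
  n : ℕ

edge? : (x : Adj n) → ∀ i j → Dec (Edge x i j)
edge? x i j = lookup (lookup x i) j Bool.≟ true

insert : Adj n → Fin n → Fin n → Adj n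
insert x a b = x [ a ]≔ (lookup x a [ b ]≔ true)

insert-row : (x : Adj n) (a b : Fin n) → lookup (insert x a b) a ≡ lookup x a [ b ]≔ true
insert-row x a b = lookup∘update a x _

insert-edge : (x : Adj n) (a b : Fin n) → Edge (insert x a b) a b
insert-edge x a b = trans (cong (λ r → lookup r b) (insert-row x a b)) (lookup∘update b (lookup x a) true)

insert-other : (x : Adj n) {a b i j : Fin n} → (i , j) ≢ (a , b) →
               lookup (lookup (insert x a b) i) j ≡ lookup (lookup x i) j
insert-other x {a} {b} {i} {j} ij≢ab with i Fin.≟ a
... | no i≢a   = cong (λ r → lookup r j) (lookup∘update′ i≢a x _)
... | yes refl = trans (cong (λ r → lookup r j) (insert-row x i b))
                       (lookup∘update′ (λ j≡b → ij≢ab (cong (i ,_) j≡b)) (lookup x i) true)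

insert-cases : (x : Adj n) {a b : Fin n} (i j : Fin n) → Edge (insert x a b) i j →
               (i , j) ≡ (a , b) ⊎ Edge x i j
insert-cases x {a} {b} i j e with ≡-dec Fin._≟_ Fin._≟_ (i , j) (a , b)
... | yes ij≡ab = inj₁ ij≡ab
... | no ij≢ab  = inj₂ (trans (sym (insert-other x ij≢ab)) e)

insert-⊇ : (x : Adj n) (a b : Fin n) → x ⊆ insert x a b
insert-⊇ x a b i j e with ≡-dec Fin._≟_ Fin._≟_ (i , j) (a , b)
... | yes refl = insert-edge x a b
... | no ij≢ab = trans (insert-other x ij≢ab) e

insert-⊆ : (x y : Adj n) {a b : Fin n} → x ⊆ y → Edge y a b → insert x a b ⊆ y
insert-⊆ x y x⊆y yab i j e with insert-cases x i j e
... | inj₁ refl = yab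
... | inj₂ xij  = x⊆y i j xij

rank-insert : (x : Adj n) (a b : Fin n) → ¬ Edge x a b → rank (insert x a b) ≡ suc (rank x)
rank-insert x a b ¬xab = totalTrue-set x a _ (countTrue-set (lookup x a) b (Bool.¬-not ¬xab))

∅ : Adj n
∅ = replicate _ (replicate _ false)

∅-edgeless : (i j : Fin n) → ¬ Edge ∅ i j
∅-edgeless i j e = contradiction (trans (sym ∅ij≡false) e) λ ()
  where
  ∅ij≡false = trans (cong (λ r → lookup r j) (lookup-replicate i _)) (lookup-replicate j false)

∅-⊆ : (x : Adj n) → ∅ ⊆ x
∅-⊆ x i j e = contradiction e (∅-edgeless i j)

rank-∅ : ∀ n → rank (∅ {n}) ≡ 0
rank-∅ n = totalTrue-replicate-false n n

tabulateAdj : {R : Fin n → Fin n → Set} → (∀ i j → Dec (R i j)) → Adj n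
tabulateAdj R? = tabulate λ i → tabulate λ j → does (R? i j)

lookup-tabulateAdj : {R : Fin n → Fin n → Set} (R? : ∀ i j → Dec (R i j)) (i j : Fin n) →
                     lookup (lookup (tabulateAdj R?) i) j ≡ does (R? i j)
lookup-tabulateAdj R? i j = trans (cong (λ r → lookup r j) (lookup∘tabulate _ i)) (lookup∘tabulate _ j)

Edge-tabulateAdj : {R : Fin n → Fin n → Set} (R? : ∀ i j → Dec (R i j)) (i j : Fin n) →
                   Edge (tabulateAdj R?) i j ⇔ R i j
Edge-tabulateAdj R? i j with R? i j | lookup-tabulateAdj R? i j
... | yes r | e = mk⇔ (λ _ → r) (λ _ → e)
... | no ¬r | e = mk⇔ (λ e′ → contradiction (trans (sym e) e′) λ ()) (λ r → contradiction r ¬r)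

Label : TotalOrder 0ℓ 0ℓ 0ℓ
Label = ×-totalOrder ≤-decTotalOrder ≤-totalOrder

open TotalOrder Label using ()
  renaming (_≤_ to _≤ˡ_; _≈_ to _≈ˡ_; refl to ≤ˡ-refl; trans to ≤ˡ-trans; antisym to ≤ˡ-antisym)

≡⇒≤ˡ : ∀ {s t} → s ≡ t → s ≤ˡ t
≡⇒≤ˡ refl = ≤ˡ-refl

≤ˡ⇒proj₁-≤ : ∀ {a b c d} → (a , b) ≤ˡ (c , d) → a ≤ℕ c
≤ˡ⇒proj₁-≤ (inj₁ (a≤c , _))   = a≤c
≤ˡ⇒proj₁-≤ (inj₂ (refl , _)) = ≤-refl

-- Shorter edges come first; this is what lets the greedy step preserve (B1).
key : Fin n × Fin n → ℕ × ℕ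
key (i , j) = toℕ j ∸ toℕ i , toℕ i

key-injective : ∀ {i j i′ j′ : Fin n} → i < j → i′ < j′ → key (i , j) ≈ˡ key (i′ , j′) → (i , j) ≡ (i′ , j′)
key-injective {i = i} {j} {i′} {j′} i<j i′<j′ (≡-length , ≡-source) =
  cong₂ _,_ (toℕ-injective ≡-source) (toℕ-injective (begin
    toℕ j                   ≡⟨ m∸n+n≡m (<⇒≤ i<j) ⟨
    toℕ j ∸ toℕ i + toℕ i   ≡⟨ cong₂ _+_ ≡-length ≡-source ⟩
    toℕ j′ ∸ toℕ i′ + toℕ i′ ≡⟨ m∸n+n≡m (<⇒≤ i′<j′) ⟩
    toℕ j′                  ∎))
  where open ≡-Reasoning

allPairs : List (Fin n × Fin n)
allPairs {n} = cartesianProduct (allFin n) (allFin n)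

∈-allPairs : (p : Fin n × Fin n) → p ∈ allPairs
∈-allPairs (i , j) = ∈-cartesianProduct⁺ (∈-allFin i) (∈-allFin j)

NewEdge : Adj n → Adj n → Pred (Fin n × Fin n) 0ℓ
NewEdge x y (i , j) = Edge y i j × ¬ Edge x i j

newEdge? : (x y : Adj n) → Decidable (NewEdge x y)
newEdge? x y (i , j) = edge? y i j ×-dec ¬? (edge? x i j)

IsLeastNewEdge : Adj n → Adj n → Pred (Fin n × Fin n) 0ℓ
IsLeastNewEdge x y p = NewEdge x y p × ∀ q → NewEdge x y q → key p ≤ˡ key q

leastNewEdge : (x y : Adj n) → (∀ p → ¬ NewEdge x y p) ⊎ ∃ (IsLeastNewEdge x y)
leastNewEdge x y with leastBy Label (newEdge? x y) key allPairs
... | inj₁ none                = inj₁ λ p → none (∈-allPairs p)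
... | inj₂ (p , new , minimal) = inj₂ (p , new , λ q → minimal (∈-allPairs q))

-- Only covers x ⋖ z are ever labelled, by the key of their unique new edge; (0 , 0) is junk.
label : Adj n → Adj n → ℕ × ℕ
label x z = [ (λ _ → 0 , 0) , key ∘ proj₁ ]′ (leastNewEdge x z)

noNewEdge⇒rank≤ : (x y : Adj n) → (∀ p → ¬ NewEdge x y p) → rank y ≤ℕ rank x
noNewEdge⇒rank≤ x y none = totalTrue-mono y x y⊆x
  where
  y⊆x : y ⊆ x
  y⊆x i j yij with edge? x i j
  ... | yes xij = xij
  ... | no ¬xij = contradiction (yij , ¬xij) (none (i , j))

insert-newEdge : (x : Adj n) {a b : Fin n} {p : Fin n × Fin n} → NewEdge x (insert x a b) p → p ≡ (a , b)
insert-newEdge x {p = i , j} (e , ¬e) with insert-cases x i j e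
... | inj₁ ij≡ab = ij≡ab
... | inj₂ xij   = contradiction xij ¬e

label-insert : (x : Adj n) (a b : Fin n) → ¬ Edge x a b → label x (insert x a b) ≡ key (a , b)
label-insert x a b ¬xab with leastNewEdge x (insert x a b)
... | inj₁ none          = contradiction (insert-edge x a b , ¬xab) (none (a , b))
... | inj₂ (_ , new , _) = cong key (insert-newEdge x new)

_≟ˢ_ : DecidableEquality Sign
plus  ≟ˢ plus  = yes refl
plus  ≟ˢ zer   = no λ ()
plus  ≟ˢ minus = no λ ()
zer   ≟ˢ plus  = no λ ()
zer   ≟ˢ zer   = yes refl
zer   ≟ˢ minus = no λ ()
minus ≟ˢ plus  = no λ ()
minus ≟ˢ zer   = no λ ()
minus ≟ˢ minus = yes refl

SatisfiesB1 : Adj n → Set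
SatisfiesB1 x = ∀ i j k l → i < j → j < k → k < l → Edge x i k → Edge x j l → Edge x j k

module _ {n : ℕ} (ε : Vec Sign n) where
  open IsNetwork

  private
    Network : Adj n → Set
    Network = IsNetwork ε

    _⋖_ : Adj n → Adj n → Set
    _⋖_ = Cover ε

    _⇝_⇝_ : Adj n → List (Adj n) → Adj n → Set
    _⇝_⇝_ = Path ε

    Increasing : Adj n → List (Adj n) → Set
    Increasing = Rising ε Label label

  ⊆-network : (x y : Adj n) → Network y → x ⊆ y → SatisfiesB1 x → Network x
  ⊆-network x y ny x⊆y b1 = record
    { ordered  = λ i j e → ordered ny i j (x⊆y i j e)
    ; noPath   = λ i j k e e′ → noPath ny i j k (x⊆y i j e) (x⊆y j k e′)
    ; B1       = b1
    ; srcSign  = λ i j e → srcSign ny i j (x⊆y i j e)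
    ; sinkSign = λ i j e → sinkSign ny i j (x⊆y i j e)
    }

  insert-least-network : (x y : Adj n) {a b : Fin n} → Network x → Network y → x ⊆ y →
                         IsLeastNewEdge x y (a , b) → Network (insert x a b)
  insert-least-network x y {a} {b} nx ny x⊆y ((yab , _) , least) =
    ⊆-network x′ y ny x′⊆y b1
    where
    x′ = insert x a b
    x′⊆y = insert-⊆ x y x⊆y yab
    -- If (j , k) is new, it is at least as long as (a , b), so neither (i , k) nor (j , l) is (a , b).
    b1 : SatisfiesB1 x′
    b1 i j k l i<j j<k k<l x′ik x′jl with edge? x j k
    ... | yes xjk = insert-⊇ x a b j k xjk
    ... | no ¬xjk
      with ≤ˡ⇒proj₁-≤ (least (j , k) (B1 ny i j k l i<j j<k k<l (x′⊆y i k x′ik) (x′⊆y j l x′jl) , ¬xjk))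
    ...   | ab≤jk with insert-cases x i k x′ik | insert-cases x j l x′jl
    ...     | inj₁ refl | _         = contradiction ab≤jk (<⇒≱ (∸-monoʳ-< i<j (<⇒≤ j<k)))
    ...     | inj₂ _    | inj₁ refl = contradiction ab≤jk (<⇒≱ (∸-monoˡ-< k<l (<⇒≤ j<k)))
    ...     | inj₂ xik  | inj₂ xjl  = contradiction (B1 nx i j k l i<j j<k k<l xik xjl) ¬xjk

  cover⇒insert : (x z : Adj n) → x ⋖ z → ∃₂ λ a b → ¬ Edge x a b × z ≡ insert x a b
  cover⇒insert x z (_ , _ , rank-z , x⊆z) with leastNewEdge x z
  ... | inj₁ none = contradiction (subst (_≤ℕ rank x) rank-z (noNewEdge⇒rank≤ x z none)) 1+n≰n
  ... | inj₂ ((a , b) , (zab , ¬xab) , _) = a , b , ¬xab ,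
    sym (⊆∧totalTrue≡⇒≡ (insert x a b) z (insert-⊆ x z x⊆z zab) (trans (rank-insert x a b ¬xab) (sym rank-z)))

  path-⊆ : (x : Adj n) (ws : List (Adj n)) (y : Adj n) → x ⇝ ws ⇝ y → x ⊆ y
  path-⊆ x []       y refl                          i j e = e
  path-⊆ x (w ∷ ws) y ((_ , _ , _ , x⊆w) , w⇝y) i j e = path-⊆ w ws y w⇝y i j (x⊆w i j e)

  path-rank : (x : Adj n) (ws : List (Adj n)) (y : Adj n) → x ⇝ ws ⇝ y → rank y ≡ length ws + rank x
  path-rank x []       y refl                           = refl
  path-rank x (w ∷ ws) y ((_ , _ , rank-w , _) , w⇝y) = begin
    rank y                    ≡⟨ path-rank w ws y w⇝y ⟩
    length ws + rank w        ≡⟨ cong (length ws +_) rank-w ⟩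
    length ws + suc (rank x)  ≡⟨ +-suc (length ws) (rank x) ⟩
    suc (length ws + rank x)  ∎
    where open ≡-Reasoning

  path-length : (x : Adj n) (ws zs : List (Adj n)) (y : Adj n) → x ⇝ ws ⇝ y → x ⇝ zs ⇝ y →
                length ws ≡ length zs
  path-length x ws zs y p q =
    +-cancelʳ-≡ (rank x) (length ws) (length zs) (trans (sym (path-rank x ws y p)) (path-rank x zs y q))

  rising-tail : (x w : Adj n) (ws : List (Adj n)) → Increasing x (w ∷ ws) → Increasing w ws
  rising-tail x w []      _       = tt
  rising-tail x w (_ ∷ _) (_ , r) = r

  cover-label : (x w : Adj n) {p : Fin n × Fin n} → x ⋖ w → NewEdge x w p → label x w ≡ key p
  cover-label x w x⋖w new with cover⇒insert x w x⋖w
  ... | a , b , ¬xab , refl = trans (label-insert x a b ¬xab) (cong key (sym (insert-newEdge x new)))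

  rising-head-≤ : (x w : Adj n) (ws : List (Adj n)) (y : Adj n) {q : Fin n × Fin n} →
                  x ⇝ w ∷ ws ⇝ y → Increasing x (w ∷ ws) → NewEdge x y q → label x w ≤ˡ key q
  rising-head-≤ x w []        y (x⋖w , refl) _ new = ≡⇒≤ˡ (cover-label x w x⋖w new)
  rising-head-≤ x w (w₂ ∷ ws) y {i , j} (x⋖w , w⇝y) (x≤w , r) (yij , ¬xij) with edge? w i j
  ... | yes wij = ≡⇒≤ˡ (cover-label x w x⋖w (wij , ¬xij))
  ... | no ¬wij = ≤ˡ-trans x≤w (rising-head-≤ w w₂ ws y w⇝y r (yij , ¬wij))

  rising-head : (x w : Adj n) (ws : List (Adj n)) (y : Adj n) → x ⇝ w ∷ ws ⇝ y → Increasing x (w ∷ ws) →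
                ∃₂ λ a b → IsLeastNewEdge x y (a , b) × w ≡ insert x a b
  rising-head x w ws y (x⋖w , w⇝y) r with cover⇒insert x w x⋖w
  ... | a , b , ¬xab , refl = a , b , ((path-⊆ w ws y w⇝y a b (insert-edge x a b) , ¬xab) , least) , refl
    where
    least : ∀ q → NewEdge x y q → key (a , b) ≤ˡ key q
    least q new = subst (_≤ˡ key q) (label-insert x a b ¬xab) (rising-head-≤ x w ws y (x⋖w , w⇝y) r new)

  leastNewEdge-unique : (x y : Adj n) {p q : Fin n × Fin n} → Network y →
                        IsLeastNewEdge x y p → IsLeastNewEdge x y q → p ≡ q
  leastNewEdge-unique x y {i , j} {i′ , j′} ny (p-new@(yij , _) , p-least) (q-new@(yi′j′ , _) , q-least) =
    key-injective (ordered ny i j yij) (ordered ny i′ j′ yi′j′) (≤ˡ-antisym (p-least _ q-new) (q-least _ p-new))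

  rising-path-unique : (x y : Adj n) (ws zs : List (Adj n)) → Network y →
                       x ⇝ ws ⇝ y → Increasing x ws → x ⇝ zs ⇝ y → Increasing x zs → ws ≡ zs
  rising-path-unique x y []       []       _  _ _ _ _ = refl
  rising-path-unique x y []       (z ∷ zs) _  p _ q _ = contradiction (path-length x [] (z ∷ zs) y p q) λ ()
  rising-path-unique x y (w ∷ ws) []       _  p _ q _ = contradiction (path-length x (w ∷ ws) [] y p q) λ ()
  rising-path-unique x y (w ∷ ws) (z ∷ zs) ny p r q s
    with rising-head x w ws y p r | rising-head x z zs y q s
  ... | a , b , ab-least , refl | c , d , cd-least , refl with leastNewEdge-unique x y ny ab-least cd-least
  ... | refl = cong (insert x a b ∷_)
    (rising-path-unique (insert x a b) y ws zs ny
      (proj₂ p) (rising-tail x _ ws r) (proj₂ q) (rising-tail x _ zs s))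

  rising-path-exists : ∀ m (x y : Adj n) → Network x → Network y → x ⊆ y → rank y ≡ m + rank x →
                       ∃ λ zs → x ⇝ zs ⇝ y × Increasing x zs
  rising-path-exists zero x y _ _ x⊆y rank-y = [] , ⊆∧totalTrue≡⇒≡ x y x⊆y (sym rank-y) , tt
  rising-path-exists (suc m) x y nx ny x⊆y rank-y with leastNewEdge x y
  ... | inj₁ none =
    contradiction (subst (_≤ℕ rank x) rank-y (noNewEdge⇒rank≤ x y none)) (<⇒≱ (s≤s (m≤n+m (rank x) m)))
  ... | inj₂ ((a , b) , ab-least@((yab , ¬xab) , least)) =
    let zs , x′⇝y , r = rising-path-exists m x′ y nx′ ny (insert-⊆ x y x⊆y yab) rank-y′
    in x′ ∷ zs , (x⋖x′ , x′⇝y) , extend zs x′⇝y r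
    where
    x′  = insert x a b
    nx′ = insert-least-network x y nx ny x⊆y ab-least
    x⋖x′ : x ⋖ x′
    x⋖x′ = nx , nx′ , rank-insert x a b ¬xab , insert-⊇ x a b
    rank-y′ : rank y ≡ m + rank x′
    rank-y′ = trans rank-y (trans (sym (+-suc m (rank x))) (cong (m +_) (sym (rank-insert x a b ¬xab))))
    extend : ∀ zs → x′ ⇝ zs ⇝ y → Increasing x′ zs → Increasing x (x′ ∷ zs)
    extend []       _    _ = tt
    extend (z ∷ zs) x′⇝y r with rising-head x′ z zs y x′⇝y r
    ... | c , d , ((ycd , ¬x′cd) , _) , refl =
      subst₂ _≤ˡ_ (sym (label-insert x a b ¬xab)) (sym (label-insert x′ c d ¬x′cd))
             (least (c , d) (ycd , ¬x′cd ∘ insert-⊇ x a b c d)) , r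

  ⊆⇒≤P : (x y : Adj n) → Network x → Network y → x ⊆ y → _≤P_ ε x y
  ⊆⇒≤P x y nx ny x⊆y =
    let zs , x⇝y , _ = rising-path-exists (rank y ∸ rank x) x y nx ny x⊆y
                                          (sym (m∸n+n≡m (totalTrue-mono x y x⊆y)))
    in zs , x⇝y

  rising-path-firstLeast : (x y : Adj n) (ws : List (Adj n)) → Network y →
                           x ⇝ ws ⇝ y → Increasing x ws → FirstLeast ε Label label x ws y
  rising-path-firstLeast x y []       _  _ _ = tt
  rising-path-firstLeast x y (w ∷ ws) ny p r z x⋖z (zs , z⇝y) z≢w
    with rising-head x w ws y p r | cover⇒insert x z x⋖z
  ... | a , b , ((yab , ¬xab) , least) , refl | c , d , ¬xcd , refl = label≤ , label≉
    where
    ycd = path-⊆ z zs y z⇝y c d (insert-edge x c d)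
    labels : label x w ≡ key (a , b) × label x z ≡ key (c , d)
    labels = label-insert x a b ¬xab , label-insert x c d ¬xcd
    label≤ : label x w ≤ˡ label x z
    label≤ = subst₂ _≤ˡ_ (sym (proj₁ labels)) (sym (proj₂ labels)) (least (c , d) (ycd , ¬xcd))
    label≉ : ¬ (label x w ≈ˡ label x z)
    label≉ eq = z≢w (cong (uncurry (insert x)) (sym (key-injective (ordered ny a b yab) (ordered ny c d ycd)
                  (subst₂ _≈ˡ_ (proj₁ labels) (proj₂ labels) eq))))

  isEL : IsEL ε Label label
  isEL x y nx ny (ws , x⇝y)
    with rising-path-exists (length ws) x y nx ny (path-⊆ x ws y x⇝y) (path-rank x ws y x⇝y)
  ... | zs , x⇝ʳy , r =
    zs , x⇝ʳy , r , (λ vs p s → rising-path-unique x y vs zs ny p s x⇝ʳy r) ,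
    rising-path-firstLeast x y zs ny x⇝ʳy r

  Admissible : Fin n → Fin n → Set
  Admissible i j = i < j × lookup ε i ≡ plus × lookup ε j ≡ minus

  admissible? : ∀ i j → Dec (Admissible i j)
  admissible? i j = i <? j ×-dec (lookup ε i ≟ˢ plus ×-dec lookup ε j ≟ˢ minus)

  complete : Adj n
  complete = tabulateAdj admissible?

  complete-edge : ∀ {i j} → Edge complete i j ⇔ Admissible i j
  complete-edge {i} {j} = Edge-tabulateAdj admissible? i j

  complete-network : Network complete
  complete-network = record
    { ordered  = λ i j e → proj₁ (Equivalence.to complete-edge e)
    ; noPath   = λ i j k e e′ → contradiction (trans (sym (sink e)) (source e′)) λ ()
    ; B1       = λ i j k l _ j<k _ e e′ → Equivalence.from complete-edge (j<k , source e′ , sink e)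
    ; srcSign  = λ i j → source
    ; sinkSign = λ i j → sink
    }
    where
    source : ∀ {i j} → Edge complete i j → lookup ε i ≡ plus
    source = proj₁ ∘ proj₂ ∘ Equivalence.to complete-edge
    sink : ∀ {i j} → Edge complete i j → lookup ε j ≡ minus
    sink = proj₂ ∘ proj₂ ∘ Equivalence.to complete-edge

  ⊆-complete : (x : Adj n) → Network x → x ⊆ complete
  ⊆-complete x nx i j e =
    Equivalence.from complete-edge (ordered nx i j e , srcSign nx i j e , sinkSign nx i j e)

  ∅-network : Network ∅
  ∅-network = ⊆-network ∅ complete complete-network (∅-⊆ complete)
                        λ i j k l _ _ _ e _ → contradiction e (∅-edgeless i k)

  rank-cover : ∀ x y → PosetCover ε x y → rank y ≡ suc (rank x)
  rank-cover x y (_ , _ , ([] , x≡y) , x≢y , _) = contradiction x≡y x≢y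
  rank-cover x y (_ , _ , (z ∷ zs , x⋖z@(_ , nz , rank-z , _) , z⇝y) , _ , between)
    with between z nz (z ∷ [] , x⋖z , refl) (zs , z⇝y)
  ... | inj₁ refl = contradiction rank-z (1+n≢n ∘ sym)
  ... | inj₂ refl = rank-z

  rank-minimal : ∀ x → Minimal ε x → rank x ≡ 0
  rank-minimal x (nx , minimal) = begin
    rank x       ≡⟨ cong rank (minimal ∅ ∅-network (⊆⇒≤P ∅ x ∅-network nx (∅-⊆ x))) ⟨
    rank (∅ {n}) ≡⟨ rank-∅ n ⟩
    0            ∎
    where open ≡-Reasoning

  maximal≡complete : ∀ x → Maximal ε x → x ≡ complete
  maximal≡complete x (nx , maximal) =
    sym (maximal complete complete-network (⊆⇒≤P x complete nx complete-network (⊆-complete x nx)))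

  graded : Graded ε
  graded = rank , rank-cover , rank-minimal ,
           λ x y mx my → cong rank (trans (maximal≡complete x mx) (sym (maximal≡complete y my)))

theorem5p6 : (n : ℕ) (ε : Vec Sign n) → FirstNonzeroPlus ε → ELShellable ε
theorem5p6 n ε _ = graded ε , Label , label , isEL ε
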